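{- Let $G$ be a finite simple graph with $n$ vertices and $m$ edges. Then \[NK(G^{ -++}) = (n-1)^{n}\,\Pi_1^{*}(G).\]
   Context: For a graph $H$, $NK(H)=\prod_{v\in V(H)} d_H(v)$ (Narumi-Katayama index). The multiplicative sum Zagreb index is $\Pi_1^*(G)=\prod_{uv\in E(G)}[d_G(u)+d_G(v)]$. For $x,y,z\in\{+,-\}$ the total transformation graph $G^{xyz}$ has vertex set $V(G)\cup E(G)$ (disjoint union) and two distinct vertices are adjacent as follows: two vertices of $G$ are adjacent iff they are adjacent in $G$ (if $x=+$), resp. non-adjacent in $G$ (if $x=-$); two edges of $G$ are adjacent iff they share an endpoint in $G$ (if $y=+$), resp. share no endpoint (if $y=-$); a vertex $u$ and an edge $e$ of $G$ are adjacent iff $u$ is incident to $e$ (if $z=+$), resp. not incident (if $z=-$). -}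

module Defs where

open import Data.Nat using (ℕ; zero; suc; _+_; _*_; _<ᵇ_)
open import Data.Bool using (Bool; true; false; not; _∧_; _∨_; if_then_else_)
open import Data.Fin using (Fin; toℕ)
import Data.Fin as Fin
open import Data.List using (List; []; _∷_; map; _++_; concatMap; allFin; filterᵇ)
open import Data.Nat.ListAction using (product)
open import Data.Product using (_×_; _,_)
open import Data.Sum using (_⊎_; inj₁; inj₂)
import Data.Sum.Properties as SumP
import Data.Product.Properties as ProdP
open import Relation.Nullary.Decidable using (⌊_⌋)
open import Relation.Binary.PropositionalEquality using (_≡_)

record Graph (n : ℕ) : Set where
  field
    adj    : Fin n → Fin n → Bool
    sym    : ∀ i j → adj i j ≡ adj j i
    irrefl : ∀ i → adj i i ≡ false
open Graph public

_==_ : ∀ {n} → Fin n → Fin n → Bool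
i == j = ⌊ i Fin.≟ j ⌋

count : ∀ {A : Set} → (A → Bool) → List A → ℕ
count f []       = 0
count f (x ∷ xs) = (if f x then 1 else 0) + count f xs

deg : ∀ {n} → Graph n → Fin n → ℕ
deg {n} G i = count (adj G i) (allFin n)

-- An edge {i,j} of G is represented by the pair (i , j) with i < j.
Edge : ℕ → Set
Edge n = Fin n × Fin n

edges : ∀ {n} → Graph n → List (Edge n)
edges {n} G =
  filterᵇ (λ { (i , j) → (toℕ i <ᵇ toℕ j) ∧ adj G i j })
          (concatMap (λ i → map (i ,_) (allFin n)) (allFin n))

Π₁* : ∀ {n} → Graph n → ℕ
Π₁* G = product (map (λ { (u , v) → deg G u + deg G v }) (edges G))

-- A finite graph given by a duplicate-free list of vertices and a Boolean adjacency
record FinGraph : Set₁ where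
  field
    Vert  : Set
    verts : List Vert
    adjH  : Vert → Vert → Bool

degH : (H : FinGraph) → FinGraph.Vert H → ℕ
degH H v = count (FinGraph.adjH H v) (FinGraph.verts H)

NK : FinGraph → ℕ
NK H = product (map (degH H) (FinGraph.verts H))

data Sign : Set where
  plus minus : Sign

sel : Sign → Bool → Bool
sel plus  b = b
sel minus b = not b

incident : ∀ {n} → Fin n → Edge n → Bool
incident u (a , b) = (u == a) ∨ (u == b)

shareEnd : ∀ {n} → Edge n → Edge n → Bool
shareEnd (a , b) (c , d) = (a == c) ∨ (a == d) ∨ (b == c) ∨ (b == d)

TVert : ℕ → Set
TVert n = Fin n ⊎ Edge n

eqT : ∀ {n} → TVert n → TVert n → Bool
eqT p q = ⌊ SumP.≡-dec Fin._≟_ (ProdP.≡-dec Fin._≟_ Fin._≟_) p q ⌋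

adjT : ∀ {n} → Sign → Sign → Sign → Graph n → TVert n → TVert n → Bool
adjT x y z G p q = if eqT p q then false else rel p q
  where
  rel : _ → _ → Bool
  rel (inj₁ u) (inj₁ v) = sel x (adj G u v)
  rel (inj₂ e) (inj₂ f) = sel y (shareEnd e f)
  rel (inj₁ u) (inj₂ e) = sel z (incident u e)
  rel (inj₂ e) (inj₁ u) = sel z (incident u e)

total : ∀ {n} → Sign → Sign → Sign → Graph n → FinGraph
total {n} x y z G = record
  { Vert  = TVert n
  ; verts = map inj₁ (allFin n) ++ map inj₂ (edges G)
  ; adjH  = adjT x y z G
  }

-- In G⁻⁺⁺ a vertex u is adjacent to the n − 1 − d(u) vertices not adjacent to it in G
-- and to the d(u) edges incident with it, so every vertex has degree n − 1. An edge ab is adjacent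
-- to its two endpoints and to the other edges meeting it. Two distinct edges share at most one
-- endpoint, so summing the incidences with a and with b over all edges counts ab twice and each
-- neighbouring edge once: ab has d(a) + d(b) − 2 neighbouring edges and degree d(a) + d(b).

module Submission where

open import Defs hiding (sym)
open import Data.Bool using (Bool; true; false; not; _∧_; _∨_; if_then_else_; T)
open import Data.Bool.Properties using (∨-assoc; if-eta; T-≡; T-∧; T-∨)
open import Data.Fin using (Fin; toℕ; _≟_)
import Data.Fin as Fin
open import Data.Fin.Properties using (suc-injective; toℕ-injective)
open import Data.List using (List; []; _∷_; map; _++_; concatMap; allFin; filterᵇ; length)
open import Data.List.Properties using (map-++; map-cong; map-∘; map-tabulate; length-tabulate)
open import Data.Nat using (ℕ; suc; _+_; _*_; _∸_; _^_; _≤_; _<_; _<ᵇ_)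
open import Data.Nat.ListAction using (sum; product)
open import Data.Nat.ListAction.Properties using (sum-++; product-++)
open import Data.Nat.Properties
  using (+-identityʳ; +-comm; +-commutativeSemigroup;
         m+n∸n≡m; <-irrefl; <-asym; ≤-antisym; ≮⇒≥; <ᵇ⇒<; <⇒<ᵇ)
open import Algebra.Properties.CommutativeSemigroup +-commutativeSemigroup using (interchange)
open import Data.Product using (_,_; proj₁)
open import Data.Sum using (_⊎_; inj₁; inj₂)
import Data.Sum.Properties as Sum
import Data.Product.Properties as Product
open import Data.Unit using (tt)
open import Data.Empty using (⊥; ⊥-elim)
open import Function using (_∘_; Equivalence)
open import Relation.Binary.PropositionalEquality
  using (_≡_; _≢_; refl; sym; trans; cong; cong₂; subst; module ≡-Reasoning)
open import Relation.Nullary using (Dec; yes; no; ¬_)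
open import Relation.Nullary.Decidable using (⌊_⌋; isYes≗does; dec-true; dec-false; toWitness)

private variable A B : Set

[_] : Bool → ℕ
[ b ] = if b then 1 else 0

∑ : List A → (A → ℕ) → ℕ
∑ xs f = sum (map f xs)

syntax ∑ xs (λ x → e) = ∑[ x ∈ xs ] e

count≡∑ : (p : A → Bool) (xs : List A) → count p xs ≡ ∑[ x ∈ xs ] [ p x ]
count≡∑ p []       = refl
count≡∑ p (x ∷ xs) = cong ([ p x ] +_) (count≡∑ p xs)

∑-cong : {f g : A → ℕ} → (∀ x → f x ≡ g x) → ∀ xs → ∑ xs f ≡ ∑ xs g
∑-cong f≗g xs = cong sum (map-cong f≗g xs)

∑-+ : (f g : A → ℕ) (xs : List A) → ∑[ x ∈ xs ] (f x + g x) ≡ ∑ xs f + ∑ xs g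
∑-+ f g []       = refl
∑-+ f g (x ∷ xs) = trans (cong (f x + g x +_) (∑-+ f g xs)) (interchange (f x) (g x) (∑ xs f) (∑ xs g))

∑-++ : (f : A → ℕ) (xs ys : List A) → ∑ (xs ++ ys) f ≡ ∑ xs f + ∑ ys f
∑-++ f xs ys = trans (cong sum (map-++ f xs ys)) (sum-++ (map f xs) (map f ys))

∑-map : (f : B → ℕ) (g : A → B) (xs : List A) → ∑ (map g xs) f ≡ ∑ xs (f ∘ g)
∑-map f g xs = cong sum (sym (map-∘ xs))

∑-concatMap : (f : B → ℕ) (g : A → List B) (xs : List A) →
              ∑ (concatMap g xs) f ≡ ∑[ x ∈ xs ] ∑ (g x) f
∑-concatMap f g []       = refl
∑-concatMap f g (x ∷ xs) = trans (∑-++ f (g x) (concatMap g xs)) (cong (∑ (g x) f +_) (∑-concatMap f g xs))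

∑-filterᵇ : (f : A → ℕ) (p : A → Bool) (xs : List A) →
            ∑ (filterᵇ p xs) f ≡ ∑[ x ∈ xs ] (if p x then f x else 0)
∑-filterᵇ f p [] = refl
∑-filterᵇ f p (x ∷ xs) with p x
... | true  = cong (f x +_) (∑-filterᵇ f p xs)
... | false = ∑-filterᵇ f p xs

∑-zero : (xs : List A) → ∑[ _ ∈ xs ] 0 ≡ 0
∑-zero []       = refl
∑-zero (x ∷ xs) = ∑-zero xs

∑-if : (b : Bool) (f : A → ℕ) (xs : List A) →
       ∑[ x ∈ xs ] (if b then f x else 0) ≡ (if b then ∑ xs f else 0)
∑-if true  f xs = refl
∑-if false f xs = ∑-zero xs

∑-one : (xs : List A) → ∑[ _ ∈ xs ] 1 ≡ length xs
∑-one []       = refl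
∑-one (x ∷ xs) = cong suc (∑-one xs)

product-const : (k : ℕ) (xs : List A) → product (map (λ _ → k) xs) ≡ k ^ length xs
product-const k []       = refl
product-const k (x ∷ xs) = cong (k *_) (product-const k xs)

map-cong-filterᵇ : {f g : A → B} (p : A → Bool) →
                   (∀ x → T (p x) → f x ≡ g x) → ∀ xs →
                   map f (filterᵇ p xs) ≡ map g (filterᵇ p xs)
map-cong-filterᵇ p f≗g [] = refl
map-cong-filterᵇ p f≗g (x ∷ xs) with p x in px
... | true  = cong₂ _∷_ (f≗g x (Equivalence.from T-≡ px)) (map-cong-filterᵇ p f≗g xs)
... | false = map-cong-filterᵇ p f≗g xs

⌊⌋-true : ∀ {P : Set} (d : Dec P) → P → ⌊ d ⌋ ≡ true
⌊⌋-true d p = trans (isYes≗does d) (dec-true d p)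

⌊⌋-false : ∀ {P : Set} (d : Dec P) → ¬ P → ⌊ d ⌋ ≡ false
⌊⌋-false d ¬p = trans (isYes≗does d) (dec-false d ¬p)

module _ {n : ℕ} where

  ==-refl : (i : Fin n) → (i == i) ≡ true
  ==-refl i = ⌊⌋-true (i ≟ i) refl

  ==-≢ : {i j : Fin n} → i ≢ j → (i == j) ≡ false
  ==-≢ {i} {j} = ⌊⌋-false (i ≟ j)

  eqT-refl : (p : TVert n) → eqT p p ≡ true
  eqT-refl p = ⌊⌋-true (Sum.≡-dec _≟_ (Product.≡-dec _≟_ _≟_) p p) refl

  eqT-≢ : {p q : TVert n} → p ≢ q → eqT p q ≡ false
  eqT-≢ {p} {q} = ⌊⌋-false (Sum.≡-dec _≟_ (Product.≡-dec _≟_ _≟_) p q)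

∑-allFin-suc : ∀ {n} (f : Fin (suc n) → ℕ) → ∑ (allFin (suc n)) f ≡ f Fin.zero + ∑ (allFin n) (f ∘ Fin.suc)
∑-allFin-suc {n} f =
  cong (f Fin.zero +_) (cong sum (trans (map-tabulate Fin.suc f) (sym (map-tabulate (λ i → i) (f ∘ Fin.suc)))))

∑-allFin-single : ∀ {n} (f : Fin n → ℕ) (a : Fin n) → (∀ i → i ≢ a → f i ≡ 0) → ∑ (allFin n) f ≡ f a
∑-allFin-single {suc n} f Fin.zero off-a = begin
  ∑ (allFin (suc n)) f                    ≡⟨ ∑-allFin-suc f ⟩
  f Fin.zero + ∑ (allFin n) (f ∘ Fin.suc)
    ≡⟨ cong (f Fin.zero +_) (trans (∑-cong (λ i → off-a (Fin.suc i) λ ()) (allFin n)) (∑-zero (allFin n))) ⟩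
  f Fin.zero + 0                          ≡⟨ +-identityʳ _ ⟩
  f Fin.zero                              ∎
  where open ≡-Reasoning
∑-allFin-single {suc n} f (Fin.suc a) off-a = begin
  ∑ (allFin (suc n)) f                    ≡⟨ ∑-allFin-suc f ⟩
  f Fin.zero + ∑ (allFin n) (f ∘ Fin.suc) ≡⟨ cong (_+ ∑ (allFin n) (f ∘ Fin.suc)) (off-a Fin.zero λ ()) ⟩
  ∑ (allFin n) (f ∘ Fin.suc)
    ≡⟨ ∑-allFin-single (f ∘ Fin.suc) a (λ i i≢a → off-a (Fin.suc i) (i≢a ∘ suc-injective)) ⟩
  f (Fin.suc a)                           ∎
  where open ≡-Reasoning

∑-allFin-if== : ∀ {n} (a : Fin n) (f : Fin n → ℕ) → ∑[ i ∈ allFin n ] (if a == i then f i else 0) ≡ f a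
∑-allFin-if== a f =
  trans (∑-allFin-single _ a (λ i i≢a → cong (λ b → if b then f i else 0) (==-≢ (i≢a ∘ sym))))
        (cong (λ b → if b then f a else 0) (==-refl a))

∑-allFin-[==] : ∀ {n} (a : Fin n) → ∑[ i ∈ allFin n ] [ i == a ] ≡ 1
∑-allFin-[==] a =
  trans (∑-allFin-single _ a (λ i i≢a → cong [_] (==-≢ i≢a))) (cong [_] (==-refl a))

length-allFin : ∀ n → length (allFin n) ≡ n
length-allFin n = length-tabulate (λ i → i)

∑-allFin-one : ∀ n → ∑[ _ ∈ allFin n ] 1 ≡ n
∑-allFin-one n = trans (∑-one (allFin n)) (length-allFin n)

[]-+-disjoint : (p q : Bool) → (T p → T q → ⊥) → [ p ] + [ q ] ≡ [ p ∨ q ]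
[]-+-disjoint true  true  disj = ⊥-elim (disj tt tt)
[]-+-disjoint true  false _    = refl
[]-+-disjoint false q     _    = refl

incident⇒endpoint : ∀ {n} {u c d : Fin n} → T (incident u (c , d)) → u ≡ c ⊎ u ≡ d
incident⇒endpoint {u = u} {c} {d} t with Equivalence.to T-∨ t
... | inj₁ u=c = inj₁ (toWitness {a? = u ≟ c} u=c)
... | inj₂ u=d = inj₂ (toWitness {a? = u ≟ d} u=d)

endpoints-determine-edge : ∀ {n} {a b c d : Fin n} → toℕ a < toℕ b → toℕ c < toℕ d →
                           a ≡ c ⊎ a ≡ d → b ≡ c ⊎ b ≡ d → (a , b) ≡ (c , d)
endpoints-determine-edge a<b c<d (inj₁ refl) (inj₁ refl) = ⊥-elim (<-irrefl refl a<b)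
endpoints-determine-edge a<b c<d (inj₁ refl) (inj₂ refl) = refl
endpoints-determine-edge a<b c<d (inj₂ refl) (inj₁ refl) = ⊥-elim (<-asym a<b c<d)
endpoints-determine-edge a<b c<d (inj₂ refl) (inj₂ refl) = ⊥-elim (<-irrefl refl a<b)

<ᵇ≡true⇒< : ∀ m n → (m <ᵇ n) ≡ true → m < n
<ᵇ≡true⇒< m n eq = <ᵇ⇒< m n (Equivalence.from T-≡ eq)

<ᵇ≡false⇒≥ : ∀ m n → (m <ᵇ n) ≡ false → n ≤ m
<ᵇ≡false⇒≥ m n eq = ≮⇒≥ (λ m<n → subst T eq (<⇒<ᵇ m<n))

allPairs : (n : ℕ) → List (Edge n)
allPairs n = concatMap (λ i → map (i ,_) (allFin n)) (allFin n)

module _ {n : ℕ} (G : Graph n) where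

  isEdge : Fin n → Fin n → Bool
  isEdge c d = (toℕ c <ᵇ toℕ d) ∧ adj G c d

  isEdge⇒< : ∀ {a b} → T (isEdge a b) → toℕ a < toℕ b
  isEdge⇒< {a} {b} t = <ᵇ⇒< (toℕ a) (toℕ b) (proj₁ (Equivalence.to T-∧ t))

  isEdge-irrefl : ∀ u → isEdge u u ≡ false
  isEdge-irrefl u with toℕ u <ᵇ toℕ u in uu
  ... | true  = ⊥-elim (<-irrefl refl (<ᵇ≡true⇒< (toℕ u) (toℕ u) uu))
  ... | false = refl

  ∑-edges : (f : Edge n → ℕ) →
            ∑ (edges G) f ≡ ∑[ c ∈ allFin n ] ∑[ d ∈ allFin n ] (if isEdge c d then f (c , d) else 0)
  ∑-edges f = trans (∑-filterᵇ f _ (allPairs n))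
    (trans (∑-concatMap _ _ (allFin n)) (∑-cong (λ c → ∑-map _ (c ,_) (allFin n)) (allFin n)))

  map-cong-edges : {f g : Edge n → B} → (∀ a b → T (isEdge a b) → f (a , b) ≡ g (a , b)) →
                   map f (edges G) ≡ map g (edges G)
  map-cong-edges f≗g = map-cong-filterᵇ _ (λ { (a , b) → f≗g a b }) (allPairs n)

  [adj]≡[isEdge]+[isEdge] : ∀ u v → [ adj G u v ] ≡ [ isEdge u v ] + [ isEdge v u ]
  [adj]≡[isEdge]+[isEdge] u v with toℕ u <ᵇ toℕ v in uv | toℕ v <ᵇ toℕ u in vu
  ... | true  | true  = ⊥-elim (<-asym (<ᵇ≡true⇒< (toℕ u) (toℕ v) uv) (<ᵇ≡true⇒< (toℕ v) (toℕ u) vu))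
  ... | true  | false = sym (+-identityʳ _)
  ... | false | true  = cong [_] (Graph.sym G u v)
  ... | false | false
    with toℕ-injective {i = u} {j = v}
           (≤-antisym (<ᵇ≡false⇒≥ (toℕ v) (toℕ u) vu) (<ᵇ≡false⇒≥ (toℕ u) (toℕ v) uv))
  ... | refl = cong [_] (irrefl G u)

  [incident]-split : ∀ u c d →
    (if isEdge c d then [ incident u (c , d) ] else 0)
      ≡ (if u == c then [ isEdge c d ] else 0) + (if u == d then [ isEdge c d ] else 0)
  [incident]-split u c d with u ≟ c | u ≟ d
  ... | yes refl | yes refl rewrite isEdge-irrefl u = refl
  ... | yes refl | no _     = sym (+-identityʳ _)
  ... | no _     | yes refl = refl
  ... | no _     | no _     = if-eta (isEdge c d)

  ∑-incident≡deg : ∀ u → ∑[ e ∈ edges G ] [ incident u e ] ≡ deg G u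
  ∑-incident≡deg u = begin
    ∑[ e ∈ edges G ] [ incident u e ]
      ≡⟨ ∑-edges _ ⟩
    ∑[ c ∈ allFin n ] ∑[ d ∈ allFin n ] (if isEdge c d then [ incident u (c , d) ] else 0)
      ≡⟨ ∑-cong (λ c → trans (∑-cong ([incident]-split u c) (allFin n)) (∑-+ _ _ (allFin n)))
                (allFin n) ⟩
    ∑[ c ∈ allFin n ] (∑[ d ∈ allFin n ] (if u == c then [ isEdge c d ] else 0)
                      + ∑[ d ∈ allFin n ] (if u == d then [ isEdge c d ] else 0))
      ≡⟨ ∑-+ _ _ (allFin n) ⟩
    ∑[ c ∈ allFin n ] ∑[ d ∈ allFin n ] (if u == c then [ isEdge c d ] else 0)
      + ∑[ c ∈ allFin n ] ∑[ d ∈ allFin n ] (if u == d then [ isEdge c d ] else 0)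
      ≡⟨ cong₂ _+_ (trans (∑-cong (λ c → ∑-if (u == c) _ (allFin n)) (allFin n)) (∑-allFin-if== u _))
                   (∑-cong (λ c → ∑-allFin-if== u _) (allFin n)) ⟩
    ∑[ v ∈ allFin n ] [ isEdge u v ] + ∑[ v ∈ allFin n ] [ isEdge v u ]
      ≡⟨ sym (∑-+ _ _ (allFin n)) ⟩
    ∑[ v ∈ allFin n ] ([ isEdge u v ] + [ isEdge v u ])
      ≡⟨ sym (∑-cong ([adj]≡[isEdge]+[isEdge] u) (allFin n)) ⟩
    ∑[ v ∈ allFin n ] [ adj G u v ]
      ≡⟨ sym (count≡∑ (adj G u) (allFin n)) ⟩
    deg G u ∎
    where open ≡-Reasoning

module _ {n : ℕ} (x y z : Sign) (G : Graph n) where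

  degH-total : ∀ p → degH (total x y z G) p
                     ≡ ∑[ v ∈ allFin n ] [ adjT x y z G p (inj₁ v) ]
                       + ∑[ e ∈ edges G ] [ adjT x y z G p (inj₂ e) ]
  degH-total p = begin
    degH (total x y z G) p
      ≡⟨ count≡∑ _ (map inj₁ (allFin n) ++ map inj₂ (edges G)) ⟩
    ∑[ q ∈ map inj₁ (allFin n) ++ map inj₂ (edges G) ] [ adjT x y z G p q ]
      ≡⟨ ∑-++ _ (map inj₁ (allFin n)) (map inj₂ (edges G)) ⟩
    ∑[ q ∈ map inj₁ (allFin n) ] [ adjT x y z G p q ] + ∑[ q ∈ map inj₂ (edges G) ] [ adjT x y z G p q ]
      ≡⟨ cong₂ _+_ (∑-map _ inj₁ (allFin n)) (∑-map _ inj₂ (edges G)) ⟩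
    ∑[ v ∈ allFin n ] [ adjT x y z G p (inj₁ v) ] + ∑[ e ∈ edges G ] [ adjT x y z G p (inj₂ e) ] ∎
    where open ≡-Reasoning

[not]+[] : ∀ b → [ not b ] + [ b ] ≡ 1
[not]+[] true  = refl
[not]+[] false = refl

module _ {n : ℕ} (G : Graph n) where

  private
    adj⁻⁺⁺ : TVert n → TVert n → Bool
    adj⁻⁺⁺ = adjT minus plus plus G

  vertex-neighbours-partition : ∀ u v → [ adj⁻⁺⁺ (inj₁ u) (inj₁ v) ] + [ adj G u v ] + [ v == u ] ≡ 1
  vertex-neighbours-partition u v with v ≟ u
  ... | yes refl rewrite eqT-refl (inj₁ v) | irrefl G v = refl
  ... | no v≢u rewrite eqT-≢ {p = inj₁ u} {q = inj₁ v} (λ { refl → v≢u refl }) =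
    trans (+-identityʳ _) ([not]+[] (adj G u v))

  degree-vertex : ∀ u → degH (total minus plus plus G) (inj₁ u) ≡ n ∸ 1
  degree-vertex u = begin
    degH (total minus plus plus G) (inj₁ u)   ≡⟨ degH-total minus plus plus G (inj₁ u) ⟩
    X + ∑[ e ∈ edges G ] [ incident u e ]    ≡⟨ cong (X +_) (∑-incident≡deg G u) ⟩
    X + deg G u                              ≡⟨ sym (m+n∸n≡m _ 1) ⟩
    X + deg G u + 1 ∸ 1                      ≡⟨ cong (_∸ 1) partition ⟩
    n ∸ 1                                    ∎
    where
    open ≡-Reasoning
    X : ℕ
    X = ∑[ v ∈ allFin n ] [ adj⁻⁺⁺ (inj₁ u) (inj₁ v) ]
    partition : X + deg G u + 1 ≡ n
    partition = begin
      X + deg G u + 1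
        ≡⟨ cong₂ (λ d k → X + d + k) (count≡∑ (adj G u) (allFin n)) (sym (∑-allFin-[==] u)) ⟩
      X + ∑[ v ∈ allFin n ] [ adj G u v ] + ∑[ v ∈ allFin n ] [ v == u ]
        ≡⟨ sym (trans (∑-+ _ _ (allFin n)) (cong (_+ _) (∑-+ _ _ (allFin n)))) ⟩
      ∑[ v ∈ allFin n ] ([ adj⁻⁺⁺ (inj₁ u) (inj₁ v) ] + [ adj G u v ] + [ v == u ])
        ≡⟨ ∑-cong (vertex-neighbours-partition u) (allFin n) ⟩
      ∑[ _ ∈ allFin n ] 1
        ≡⟨ ∑-allFin-one n ⟩
      n ∎

  [incident]-endpoints : ∀ {a b : Fin n} → a ≢ b → ∀ v → [ incident v (a , b) ] ≡ [ v == a ] + [ v == b ]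
  [incident]-endpoints {a} a≢b v with v ≟ a
  ... | yes refl rewrite ==-≢ a≢b = refl
  ... | no _ = refl

  [incident]+[incident] : ∀ {a b c d : Fin n} → toℕ a < toℕ b → toℕ c < toℕ d →
    [ incident a (c , d) ] + [ incident b (c , d) ]
      ≡ [ adj⁻⁺⁺ (inj₂ (a , b)) (inj₂ (c , d)) ]
        + ([ eqT (inj₂ (a , b)) (inj₂ (c , d)) ] + [ eqT (inj₂ (a , b)) (inj₂ (c , d)) ])
  [incident]+[incident] {a} {b} {c} {d} a<b c<d with Product.≡-dec _≟_ _≟_ (a , b) (c , d)
  ... | yes refl rewrite ==-refl a | ==-refl b | ==-≢ {i = b} {j = a} (λ b≡a → <-irrefl (cong toℕ (sym b≡a)) a<b) =
    refl
  ... | no e≢f =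
    trans ([]-+-disjoint _ _ meets-once) (trans (cong [_] (∨-assoc (a == c) (a == d) _)) (sym (+-identityʳ _)))
    where
    meets-once : T (incident a (c , d)) → T (incident b (c , d)) → ⊥
    meets-once ia ib = e≢f (endpoints-determine-edge a<b c<d (incident⇒endpoint ia) (incident⇒endpoint ib))

  [eqT]-edges : ∀ {a b} → T (isEdge G a b) → ∀ c d →
    (if isEdge G c d then [ eqT (inj₂ (a , b)) (inj₂ (c , d)) ] else 0) ≡ (if a == c then [ b == d ] else 0)
  [eqT]-edges {a} {b} ab c d = by-cases c d (a ≟ c) (b ≟ d)
    where
    -- `with a ≟ c` would also abstract the copy of this decision inside eqT, blocking eqT-refl.
    by-cases : ∀ c d → Dec (a ≡ c) → Dec (b ≡ d) →
      (if isEdge G c d then [ eqT (inj₂ (a , b)) (inj₂ (c , d)) ] else 0) ≡ (if a == c then [ b == d ] else 0)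
    by-cases c d (yes refl) (yes refl)
      rewrite eqT-refl (inj₂ (a , b)) | Equivalence.to T-≡ ab | ==-refl a | ==-refl b = refl
    by-cases c d (yes refl) (no b≢d)
      rewrite eqT-≢ {p = inj₂ (a , b)} {q = inj₂ (a , d)} (λ { refl → b≢d refl })
            | ==-refl a | ==-≢ b≢d = if-eta (isEdge G a d)
    by-cases c d (no a≢c) _
      rewrite eqT-≢ {p = inj₂ (a , b)} {q = inj₂ (c , d)} (λ { refl → a≢c refl }) | ==-≢ a≢c =
      if-eta (isEdge G c d)

  edge-occurs-once : ∀ {a b} → T (isEdge G a b) → ∑[ f ∈ edges G ] [ eqT (inj₂ (a , b)) (inj₂ f) ] ≡ 1
  edge-occurs-once {a} {b} ab = begin
    ∑[ f ∈ edges G ] [ eqT (inj₂ (a , b)) (inj₂ f) ]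
      ≡⟨ ∑-edges G _ ⟩
    ∑[ c ∈ allFin n ] ∑[ d ∈ allFin n ] (if isEdge G c d then [ eqT (inj₂ (a , b)) (inj₂ (c , d)) ] else 0)
      ≡⟨ ∑-cong (λ c → trans (∑-cong ([eqT]-edges ab c) (allFin n)) (∑-if (a == c) _ (allFin n))) (allFin n) ⟩
    ∑[ c ∈ allFin n ] (if a == c then ∑[ d ∈ allFin n ] [ b == d ] else 0)
      ≡⟨ ∑-allFin-if== a _ ⟩
    ∑[ d ∈ allFin n ] [ b == d ]
      ≡⟨ ∑-allFin-if== b (λ _ → 1) ⟩
    1 ∎
    where open ≡-Reasoning

  degree-edge : ∀ {a b} → T (isEdge G a b) → degH (total minus plus plus G) (inj₂ (a , b)) ≡ deg G a + deg G b
  degree-edge {a} {b} ab = begin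
    degH (total minus plus plus G) (inj₂ (a , b))  ≡⟨ degH-total minus plus plus G (inj₂ (a , b)) ⟩
    ∑[ v ∈ allFin n ] [ incident v (a , b) ] + Y   ≡⟨ cong (_+ Y) endpoints ⟩
    2 + Y                                          ≡⟨ +-comm 2 Y ⟩
    Y + (1 + 1)                                    ≡⟨ cong (λ k → Y + (k + k)) (sym (edge-occurs-once ab)) ⟩
    Y + (E + E)
      ≡⟨ sym (trans (∑-+ _ _ (edges G)) (cong (Y +_) (∑-+ _ _ (edges G)))) ⟩
    ∑[ f ∈ edges G ] ([ adj⁻⁺⁺ (inj₂ (a , b)) (inj₂ f) ]
                     + ([ eqT (inj₂ (a , b)) (inj₂ f) ] + [ eqT (inj₂ (a , b)) (inj₂ f) ]))
      ≡⟨ cong sum (map-cong-edges G (λ c d cd → sym ([incident]+[incident] a<b (isEdge⇒< G cd)))) ⟩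
    ∑[ f ∈ edges G ] ([ incident a f ] + [ incident b f ])
      ≡⟨ ∑-+ _ _ (edges G) ⟩
    ∑[ f ∈ edges G ] [ incident a f ] + ∑[ f ∈ edges G ] [ incident b f ]
      ≡⟨ cong₂ _+_ (∑-incident≡deg G a) (∑-incident≡deg G b) ⟩
    deg G a + deg G b ∎
    where
    open ≡-Reasoning
    a<b : toℕ a < toℕ b
    a<b = isEdge⇒< G ab
    Y E : ℕ
    Y = ∑[ f ∈ edges G ] [ adj⁻⁺⁺ (inj₂ (a , b)) (inj₂ f) ]
    E = ∑[ f ∈ edges G ] [ eqT (inj₂ (a , b)) (inj₂ f) ]
    endpoints : ∑[ v ∈ allFin n ] [ incident v (a , b) ] ≡ 2
    endpoints = trans (∑-cong ([incident]-endpoints (λ a≡b → <-irrefl (cong toℕ a≡b) a<b)) (allFin n))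
                      (trans (∑-+ _ _ (allFin n)) (cong₂ _+_ (∑-allFin-[==] a) (∑-allFin-[==] b)))

theorem10 : (n : ℕ) (G : Graph n) →
    NK (total minus plus plus G) ≡ (n ∸ 1) ^ n * Π₁* G
theorem10 n G = begin
  NK H
    ≡⟨ cong product (map-++ (degH H) (map inj₁ (allFin n)) (map inj₂ (edges G))) ⟩
  product (map (degH H) (map inj₁ (allFin n)) ++ map (degH H) (map inj₂ (edges G)))
    ≡⟨ product-++ (map (degH H) (map inj₁ (allFin n))) (map (degH H) (map inj₂ (edges G))) ⟩
  product (map (degH H) (map inj₁ (allFin n))) * product (map (degH H) (map inj₂ (edges G)))
    ≡⟨ cong₂ (λ xs ys → product xs * product ys) (sym (map-∘ (allFin n))) (sym (map-∘ (edges G))) ⟩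
  product (map (degH H ∘ inj₁) (allFin n)) * product (map (degH H ∘ inj₂) (edges G))
    ≡⟨ cong₂ (λ xs ys → product xs * product ys) (map-cong (degree-vertex G) (allFin n))
                                                 (map-cong-edges G (λ a b → degree-edge G)) ⟩
  product (map (λ _ → n ∸ 1) (allFin n)) * Π₁* G
    ≡⟨ cong (_* Π₁* G) (trans (product-const (n ∸ 1) (allFin n)) (cong ((n ∸ 1) ^_) (length-allFin n))) ⟩
  (n ∸ 1) ^ n * Π₁* G ∎
  where
  open ≡-Reasoning
  H : FinGraph
  H = total minus plus plus G
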